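{- Let $P_{n_1},\dots,P_{n_r}$ be oriented paths, $P_{n_i}$ having vertices $a_{i,1}\to\cdots\to a_{i,n_i}$, each equipped with an almost simple pebbling assignment $(S_{P_{n_i}})$ such that $P_{n_i}\cong[S_{P_{n_i}}]$. Let $G=\square_{i=1}^r P_{n_i}$ carry the corresponding almost simple pebbling assignment $(S_G)$. Then $G\cong [S_G]$ as directed graphs.
   Context: A simple pebbling assignment on an oriented path is one with two or three pebbles on the source, exactly one pebble on each other non-sink vertex, and any number on the sink. An almost simple pebbling assignment on an oriented path $v_1\to\cdots\to v_n$ is either a simple one, or (type 1) one with some number $k$ of pebbles on $v_{n-1}$, any number on the sink $v_n$, and zero or one pebble on all other vertices, or (type 2) one with four or five pebbles on some vertex $v_j$, zero pebbles on $v_{j+1}$, zero or one pebble on all other non-sink vertices, and any number on the sink. The Cartesian product $G=\square_{i=1}^r P_{n_i}$ has vertex set all tuples $(x_1,\dots,x_r)$ with $x_i\in\{a_{i,1},\dots,a_{i,n_i}\}$, and a directed edge from $(x_1,\dots,x_r)$ to $(y_1,\dots,y_r)$ iff they agree in all coordinates except one coordinate $i$, where $x_i=a_{i,j}$, $y_i=a_{i,j+1}$. For each $i$, the $i$-th axis is the path of vertices whose $i$-th coordinate is $a_{i,j}$ ($1\le j\le n_i$) and whose $l$-th coordinate is $a_{l,n_l}$ for $l\ne i$; it is isomorphic to $P_{n_i}$. The corresponding almost simple assignment $(S_G)$ places on each non-sink vertex of the $i$-th axis the number of pebbles $(S_{P_{n_i}})$ places on the corresponding vertex of $P_{n_i}$,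 any number of pebbles on $(a_{1,n_1},\dots,a_{r,n_r})$, and zero or one pebble on every remaining vertex. A pebbling move along an edge $(v,w)$ (allowed when $v$ has at least two pebbles) removes two pebbles from $v$ and adds one to $w$. The assignment graph $[S]$ of an assignment $S$ has as vertices all assignments reachable from $S$ by finite sequences of pebbling moves (including $S$), with a directed edge $A\to B$ whenever $B$ is obtained from $A$ by one pebbling move. -}

module Defs where

open import Data.Nat using (ℕ; zero; suc; _+_; _≤_; _<_)
open import Data.Fin using (Fin; toℕ)
open import Data.Vec using (Vec; []; _∷_; lookup)
open import Data.Product using (Σ; _×_; _,_)
open import Data.Sum using (_⊎_)
open import Data.Unit using (⊤)
open import Relation.Nullary using (¬_)
open import Relation.Binary.PropositionalEquality using (_≡_; _≢_)
open import Relation.Binary.Construct.Closure.ReflexiveTransitive using (Star)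

record Digraph : Set₁ where
  field
    V   : Set
    _≈_ : V → V → Set
    E   : V → V → Set

mkDigraph : (V : Set) → (V → V → Set) → Digraph
mkDigraph V E = record { V = V ; _≈_ = _≡_ ; E = E }

record Iso (D₁ D₂ : Digraph) : Set where
  module D₁ = Digraph D₁
  module D₂ = Digraph D₂
  field
    f       : D₁.V → D₂.V
    f-cong  : ∀ {x y} → D₁._≈_ x y → D₂._≈_ (f x) (f y)
    f-inj   : ∀ {x y} → D₂._≈_ (f x) (f y) → D₁._≈_ x y
    f-surj  : ∀ w → Σ D₁.V (λ v → D₂._≈_ (f v) w)
    f-edge  : ∀ {x y} → D₁.E x y → D₂.E (f x) (f y)
    f-edge⁻ : ∀ {x y} → D₂.E (f x) (f y) → D₁.E x y

Assignment : Set → Set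
Assignment V = V → ℕ

Move : {V : Set} → (V → V → Set) → Assignment V → Assignment V → Set
Move {V} E A B =
  Σ V λ u → Σ V λ w →
    E u w × 2 ≤ A u × A u ≡ 2 + B u × B w ≡ 1 + A w ×
    (∀ x → x ≢ u → x ≢ w → B x ≡ A x)

Reachable : {V : Set} → (V → V → Set) → Assignment V → Assignment V → Set
Reachable E S B = Star (Move E) S B

AssignmentGraph : (V : Set) → (V → V → Set) → Assignment V → Digraph
AssignmentGraph V E S = record
  { V   = Σ (Assignment V) (Reachable E S)
  ; _≈_ = λ A B → ∀ x → Data.Product.proj₁ A x ≡ Data.Product.proj₁ B x
  ; E   = λ A B → Move E (Data.Product.proj₁ A) (Data.Product.proj₁ B)
  }

-- The oriented path P_n : vertices Fin n (index j stands for v_{j+1}),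
-- edges j → j+1.

PathEdge : {n : ℕ} → Fin n → Fin n → Set
PathEdge x y = suc (toℕ x) ≡ toℕ y

PathGraph : ℕ → Digraph
PathGraph n = mkDigraph (Fin n) PathEdge

IsSource : {n : ℕ} → Fin n → Set
IsSource x = toℕ x ≡ 0

IsSink : {n : ℕ} → Fin n → Set
IsSink {n} x = suc (toℕ x) ≡ n

Simple : (n : ℕ) → Assignment (Fin n) → Set
Simple n S =
  (∀ x → IsSource x → S x ≡ 2 ⊎ S x ≡ 3) ×
  (∀ x → ¬ IsSource x → ¬ IsSink x → S x ≡ 1)

AlmostSimple₁ : (n : ℕ) → Assignment (Fin n) → Set
AlmostSimple₁ n S = ∀ x → 2 + toℕ x < n → S x ≤ 1

AlmostSimple₂ : (n : ℕ) → Assignment (Fin n) → Set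
AlmostSimple₂ n S =
  Σ (Fin n) λ j → suc (toℕ j) < n ×
    (S j ≡ 4 ⊎ S j ≡ 5) ×
    (∀ y → toℕ y ≡ suc (toℕ j) → S y ≡ 0) ×
    (∀ y → y ≢ j → ¬ IsSink y → S y ≤ 1)

AlmostSimple : (n : ℕ) → Assignment (Fin n) → Set
AlmostSimple n S = Simple n S ⊎ AlmostSimple₁ n S ⊎ AlmostSimple₂ n S

Vertex : {r : ℕ} → Vec ℕ r → Set
Vertex []       = ⊤
Vertex (n ∷ ns) = Fin n × Vertex ns

ProdEdge : {r : ℕ} (ns : Vec ℕ r) → Vertex ns → Vertex ns → Set
ProdEdge []       _        _        = Data.Empty.⊥
  where import Data.Empty
ProdEdge (n ∷ ns) (x , v) (y , w) =
  (PathEdge x y × v ≡ w) ⊎ (x ≡ y × ProdEdge ns v w)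

ProdGraph : {r : ℕ} → Vec ℕ r → Digraph
ProdGraph ns = mkDigraph (Vertex ns) (ProdEdge ns)

coord : {r : ℕ} (ns : Vec ℕ r) → Vertex ns → (i : Fin r) → Fin (lookup ns i)
coord (n ∷ ns) (x , v) Fin.zero    = x
  where import Data.Fin as Fin
coord (n ∷ ns) (x , v) (Fin.suc i) = coord ns v i
  where import Data.Fin as Fin

OnAxis : {r : ℕ} (ns : Vec ℕ r) → Fin r → Vertex ns → Set
OnAxis ns i v = ∀ l → l ≢ i → IsSink (coord ns v l)

Corresponding : {r : ℕ} (ns : Vec ℕ r) →
                ((i : Fin r) → Assignment (Fin (lookup ns i))) →
                Assignment (Vertex ns) → Set
Corresponding {r} ns S SG =
  (∀ (i : Fin r) v → OnAxis ns i v → ¬ IsSink (coord ns v i) →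
     SG v ≡ S i (coord ns v i)) ×
  -- vertices on no axis get 0 or 1 pebble (the sink is unconstrained)
  (∀ v → (∀ i → ¬ OnAxis ns i v) → SG v ≤ 1)

{-# OPTIONS --safe #-}
module Submission where

-- Induct on r, writing G = P_{n₁} □ G′ where G′ is realised by the slice of S_G through the sink
-- of P_{n₁}.  For a product of two realised digraphs with sinks t₁ and t₂, the reachable
-- assignments are exactly the glued ones: a reachable assignment of the first factor on the row
-- through t₂, one of the second factor on the column through t₁, and the initial assignment, with
-- at most one pebble per vertex, elsewhere.  No move can start off these two axes, so the moves of
-- the product are exactly the moves of one factor.  Glueing is injective because on a path the
-- count on the sink is fixed by the other counts, Σ X(p)·2^p being invariant under moves.

open import Defs
open import Data.Nat using (ℕ; zero; suc; _+_; _*_; _∸_; _^_; _≤_; _<_; z≤n; s≤s)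
open import Data.Nat.Properties
open import Data.Nat.Solver using (module +-*-Solver)
open import Data.Fin as Fin using (Fin; toℕ; fromℕ; punchIn; punchOut)
open import Data.Fin.Properties as Finₚ
  using (toℕ<n; toℕ-fromℕ; toℕ-injective; punchInᵢ≢i; punchIn-injective; punchIn-punchOut)
open import Data.Vec using (Vec; lookup; []; _∷_)
open import Data.Vec.Functional using (removeAt)
open import Data.Product using (Σ; _×_; _,_; proj₁; proj₂)
open import Data.Product.Properties using (≡-dec)
open import Data.Sum using (_⊎_; inj₁; inj₂)
open import Data.Unit using (tt)
open import Data.Empty using (⊥-elim)
open import Function using (_∘_; case_of_)
open import Relation.Nullary using (¬_; Dec; yes; no)
open import Relation.Binary.Definitions using (DecidableEquality)
open import Relation.Binary.PropositionalEquality
open import Relation.Binary.Construct.Closure.ReflexiveTransitive using (ε; _◅_; _◅◅_)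
open import Algebra.Properties.CommutativeMonoid.Sum +-0-commutativeMonoid
  using (sum; sum-remove; sum-cong-≗)

private
  variable
    V : Set
    E : V → V → Set

MoveAlong : (V → V → Set) → V → V → Assignment V → Assignment V → Set
MoveAlong E u w A B =
  E u w × 2 ≤ A u × A u ≡ 2 + B u × B w ≡ 1 + A w × (∀ x → x ≢ u → x ≢ w → B x ≡ A x)

NoOutEdges : (V → V → Set) → V → Set
NoOutEdges E t = ∀ w → ¬ E t w

Realises : (V → V → Set) → Assignment V → Set
Realises {V} E S = Iso (mkDigraph V E) (AssignmentGraph V E S)

moveAlong-resp-≗ : ∀ {u w} {A A′ B B′ : Assignment V} → A ≗ A′ → B ≗ B′ →
                   MoveAlong E u w A B → MoveAlong E u w A′ B′
moveAlong-resp-≗ {u = u} {w} A≗A′ B≗B′ (e , 2≤Au , Au≡2+Bu , Bw≡1+Aw , frame) =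
  e , subst (2 ≤_) (A≗A′ u) 2≤Au ,
  trans (sym (A≗A′ u)) (trans Au≡2+Bu (cong (2 +_) (B≗B′ u))) ,
  trans (sym (B≗B′ w)) (trans Bw≡1+Aw (cong suc (A≗A′ w))) ,
  λ x x≢u x≢w → trans (sym (B≗B′ x)) (trans (frame x x≢u x≢w) (A≗A′ x))

move-resp-≗ : ∀ {A A′ B B′ : Assignment V} → A ≗ A′ → B ≗ B′ → Move E A B → Move E A′ B′
move-resp-≗ {E = E} A≗A′ B≗B′ (u , w , mv) = u , w , moveAlong-resp-≗ {E = E} A≗A′ B≗B′ mv

moveAlong-source≢target : ∀ {u w} {A B : Assignment V} → MoveAlong E u w A B → u ≢ w
moveAlong-source≢target {A = A} (_ , _ , Au≡2+Bu , Bu≡1+Au , _) refl =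
  m≢1+n+m (A _) (trans Au≡2+Bu (cong (2 +_) Bu≡1+Au))

moveAlong-functional : ∀ {u w} {A A′ B B′ : Assignment V} → DecidableEquality V → A ≗ A′ →
                       MoveAlong E u w A B → MoveAlong E u w A′ B′ → B ≗ B′
moveAlong-functional {u = u} {w} _≟_ A≗A′
  (_ , _ , Au≡2+Bu , Bw≡1+Aw , frame) (_ , _ , A′u≡2+B′u , B′w≡1+A′w , frame′) x
  with x ≟ u | x ≟ w
... | yes refl | _        = +-cancelˡ-≡ 2 _ _ (trans (sym Au≡2+Bu) (trans (A≗A′ x) A′u≡2+B′u))
... | no _     | yes refl = trans Bw≡1+Aw (trans (cong suc (A≗A′ x)) (sym B′w≡1+A′w))
... | no x≢u   | no x≢w   = trans (frame x x≢u x≢w) (trans (A≗A′ x) (sym (frame′ x x≢u x≢w)))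

fire : DecidableEquality V → Assignment V → V → V → Assignment V
fire _≟_ A u w x with x ≟ u | x ≟ w
... | yes _ | _     = A u ∸ 2
... | no _  | yes _ = suc (A w)
... | no _  | no _  = A x

moveAlong-fire : ∀ {u w} {A : Assignment V} (_≟_ : DecidableEquality V) →
                 E u w → 2 ≤ A u → u ≢ w → MoveAlong E u w A (fire _≟_ A u w)
moveAlong-fire {u = u} {w} {A} _≟_ e 2≤Au u≢w =
  e , 2≤Au , trans (sym (m+[n∸m]≡n 2≤Au)) (cong (2 +_) (sym at-source)) , at-target , elsewhere
  where
  at-source : fire _≟_ A u w u ≡ A u ∸ 2
  at-source with u ≟ u
  ... | yes _   = refl
  ... | no u≢u = ⊥-elim (u≢u refl)
  at-target : fire _≟_ A u w w ≡ suc (A w)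
  at-target with w ≟ u | w ≟ w
  ... | yes w≡u | _       = ⊥-elim (u≢w (sym w≡u))
  ... | no _    | yes _   = refl
  ... | no _    | no w≢w = ⊥-elim (w≢w refl)
  elsewhere : ∀ x → x ≢ u → x ≢ w → fire _≟_ A u w x ≡ A x
  elsewhere x x≢u x≢w with x ≟ u | x ≟ w
  ... | yes x≡u | _       = ⊥-elim (x≢u x≡u)
  ... | no _    | yes x≡w = ⊥-elim (x≢w x≡w)
  ... | no _    | no _    = refl

moveAlong-sink-≤ : ∀ {t u w} {A B : Assignment V} → DecidableEquality V → NoOutEdges E t →
                   MoveAlong E u w A B → A t ≤ B t
moveAlong-sink-≤ {t = t} {u} {w} {A} _≟_ t-sink (e , _ , _ , Bw≡1+Aw , frame) with w ≟ t
... | yes refl = subst (A w ≤_) (sym Bw≡1+Aw) (n≤1+n (A w))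
... | no w≢t   = ≤-reflexive (sym (frame t t≢u (w≢t ∘ sym)))
  where
  t≢u : t ≢ u
  t≢u refl = t-sink w e

reachable-sink-≤ : ∀ {t} {A B : Assignment V} → DecidableEquality V → NoOutEdges E t →
                   Reachable E A B → A t ≤ B t
reachable-sink-≤ _≟_ t-sink ε                   = ≤-refl
reachable-sink-≤ _≟_ t-sink ((_ , _ , mv) ◅ mvs) =
  ≤-trans (moveAlong-sink-≤ _≟_ t-sink mv) (reachable-sink-≤ _≟_ t-sink mvs)

reachable-resp-≗ˡ : ∀ {A A′ B : Assignment V} → A ≗ A′ → Reachable E A′ B →
                    Σ (Assignment V) λ B′ → Reachable E A B′ × B′ ≗ B
reachable-resp-≗ˡ A≗A′ ε          = _ , ε , A≗A′
reachable-resp-≗ˡ A≗A′ (mv ◅ mvs) = _ , move-resp-≗ (sym ∘ A≗A′) (λ _ → refl) mv ◅ mvs , λ _ → refl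

module Realisation {V : Set} {E : V → V → Set} {S : Assignment V} (φ : Realises E S) where

  assignment : V → Assignment V
  assignment p = proj₁ (Iso.f φ p)

  assignment-reachable : ∀ p → Reachable E S (assignment p)
  assignment-reachable p = proj₂ (Iso.f φ p)

  assignment-injective : ∀ {p q} → assignment p ≗ assignment q → p ≡ q
  assignment-injective = Iso.f-inj φ

  assignment-surjective : ∀ {X} → Reachable E S X → Σ V λ p → assignment p ≗ X
  assignment-surjective S↝X = Iso.f-surj φ (_ , S↝X)

  assignment-edge : ∀ {p q} → E p q → Move E (assignment p) (assignment q)
  assignment-edge = Iso.f-edge φ

  assignment-move : ∀ {p X} → Move E (assignment p) X → Σ V λ q → E p q × assignment q ≗ X
  assignment-move {p} mv with assignment-surjective (assignment-reachable p ◅◅ mv ◅ ε)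
  ... | q , Aq≗X = q , Iso.f-edge⁻ φ (move-resp-≗ (λ _ → refl) (sym ∘ Aq≗X) mv) , Aq≗X

removeAt-cong-off : ∀ {n} {f g : Fin (suc n) → ℕ} (a : Fin (suc n)) →
                    (∀ x → x ≢ a → f x ≡ g x) → removeAt f a ≗ removeAt g a
removeAt-cong-off a agree j = agree (punchIn a j) (punchInᵢ≢i a j)

sum≡⇒≡-at : ∀ {n} {f g : Fin (suc n) → ℕ} (a : Fin (suc n)) →
            (∀ x → x ≢ a → f x ≡ g x) → sum f ≡ sum g → f a ≡ g a
sum≡⇒≡-at {f = f} {g} a agree Σf≡Σg = +-cancelʳ-≡ (sum (removeAt g a)) (f a) (g a) (begin
  f a + sum (removeAt g a) ≡⟨ cong (f a +_) (sum-cong-≗ (removeAt-cong-off a agree)) ⟨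
  f a + sum (removeAt f a) ≡⟨ sum-remove f ⟨
  sum f                    ≡⟨ Σf≡Σg ⟩
  sum g                    ≡⟨ sum-remove g ⟩
  g a + sum (removeAt g a) ∎)
  where open ≡-Reasoning

sum-cong-off₂ : ∀ {n} {f g : Fin (suc n) → ℕ} {u w} → u ≢ w →
                (∀ x → x ≢ u → x ≢ w → f x ≡ g x) → f u + f w ≡ g u + g w → sum f ≡ sum g
sum-cong-off₂ {zero} {u = Fin.zero} {Fin.zero} u≢w _ _ = ⊥-elim (u≢w refl)
sum-cong-off₂ {suc n} {f} {g} {u} {w} u≢w agree fu+fw≡gu+gw = begin
  sum f                  ≡⟨ split f ⟩
  f u + (f w + rest f)   ≡⟨ +-assoc (f u) (f w) (rest f) ⟨
  f u + f w + rest f     ≡⟨ cong₂ _+_ fu+fw≡gu+gw (sum-cong-≗ rest-agree) ⟩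
  g u + g w + rest g     ≡⟨ +-assoc (g u) (g w) (rest g) ⟩
  g u + (g w + rest g)   ≡⟨ split g ⟨
  sum g                  ∎
  where
  open ≡-Reasoning
  j : Fin (suc n)
  j = punchOut u≢w
  rest : (Fin (suc (suc n)) → ℕ) → ℕ
  rest h = sum (removeAt (removeAt h u) j)
  split : ∀ h → sum h ≡ h u + (h w + rest h)
  split h = trans (sum-remove h) (cong (h u +_)
    (trans (sum-remove (removeAt h u)) (cong (λ x → h x + rest h) (punchIn-punchOut u≢w))))
  rest-agree : removeAt (removeAt f u) j ≗ removeAt (removeAt g u) j
  rest-agree k = agree (punchIn u (punchIn j k)) (punchInᵢ≢i u _) λ ≡w →
    punchInᵢ≢i j k (punchIn-injective u _ _ (trans ≡w (sym (punchIn-punchOut u≢w))))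

isSink⇒noOutEdges : ∀ {n} {t : Fin n} → IsSink t → NoOutEdges PathEdge t
isSink⇒noOutEdges t-sink w e = <-irrefl (trans (sym e) t-sink) (toℕ<n w)

isSink-fromℕ : ∀ m → IsSink (fromℕ m)
isSink-fromℕ m = cong suc (toℕ-fromℕ m)

isSink⇒≡fromℕ : ∀ {m} {p : Fin (suc m)} → IsSink p → p ≡ fromℕ m
isSink⇒≡fromℕ {m} p-sink = toℕ-injective (trans (suc-injective p-sink) (sym (toℕ-fromℕ m)))

weight : ∀ {n} → Assignment (Fin (suc n)) → ℕ
weight X = sum λ p → X p * 2 ^ toℕ p

moveAlong-weight : ∀ {n u w} {X Y : Assignment (Fin (suc n))} →
                   MoveAlong PathEdge u w X Y → weight Y ≡ weight X
moveAlong-weight {u = u} {w} {X} {Y} mv@(e , _ , Xu≡2+Yu , Yw≡1+Xw , frame) =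
  sum-cong-off₂ (moveAlong-source≢target {E = PathEdge} mv)
    (λ x x≢u x≢w → cong (_* 2 ^ toℕ x) (frame x x≢u x≢w)) (begin
      Y u * c + Y w * 2 ^ toℕ w        ≡⟨ cong₂ (λ a b → Y u * c + a * b) Yw≡1+Xw 2^w≡2c ⟩
      Y u * c + (1 + X w) * (2 * c)    ≡⟨ shuffle (Y u) (X w) c ⟩
      (2 + Y u) * c + X w * (2 * c)    ≡⟨ cong₂ (λ a b → a * c + X w * b) Xu≡2+Yu 2^w≡2c ⟨
      X u * c + X w * 2 ^ toℕ w        ∎)
  where
  open ≡-Reasoning
  open +-*-Solver
  c : ℕ
  c = 2 ^ toℕ u
  2^w≡2c : 2 ^ toℕ w ≡ 2 * c
  2^w≡2c = cong (2 ^_) (sym e)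
  shuffle : ∀ y x c → y * c + (1 + x) * (2 * c) ≡ (2 + y) * c + x * (2 * c)
  shuffle = solve 3 (λ y x c → y :* c :+ (con 1 :+ x) :* (con 2 :* c)
                             := (con 2 :+ y) :* c :+ x :* (con 2 :* c)) refl

reachable-weight : ∀ {n} {X Y : Assignment (Fin (suc n))} →
                   Reachable PathEdge X Y → weight Y ≡ weight X
reachable-weight ε                   = refl
reachable-weight ((_ , _ , mv) ◅ mvs) = trans (reachable-weight mvs) (moveAlong-weight mv)

path-sink-determined : ∀ {m} {S X Y : Assignment (Fin (suc m))} →
                       Reachable PathEdge S X → Reachable PathEdge S Y →
                       (∀ p → p ≢ fromℕ m → X p ≡ Y p) → X (fromℕ m) ≡ Y (fromℕ m)
path-sink-determined {m} S↝X S↝Y agree =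
  *-cancelʳ-≡ _ _ (2 ^ toℕ (fromℕ m)) {{m^n≢0 2 (toℕ (fromℕ m))}}
    (sum≡⇒≡-at (fromℕ m) (λ p p≢t → cong (_* 2 ^ toℕ p) (agree p p≢t))
      (trans (reachable-weight S↝X) (sym (reachable-weight S↝Y))))

_□_ : {V₁ V₂ : Set} → (V₁ → V₁ → Set) → (V₂ → V₂ → Set) → V₁ × V₂ → V₁ × V₂ → Set
(E₁ □ E₂) (p , v) (q , w) = (E₁ p q × v ≡ w) ⊎ (p ≡ q × E₂ v w)

module Product
  {V₁ V₂ : Set} {E₁ : V₁ → V₁ → Set} {E₂ : V₂ → V₂ → Set}
  (_≟₁_ : DecidableEquality V₁) (_≟₂_ : DecidableEquality V₂)
  {t₁ : V₁} {t₂ : V₂} (t₁-sink : NoOutEdges E₁ t₁) (t₂-sink : NoOutEdges E₂ t₂)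
  {S₁ : Assignment V₁} {S₂ : Assignment V₂} (φ : Realises E₁ S₁) (ψ : Realises E₂ S₂)
  (t₁-determined : ∀ {X Y} → Reachable E₁ S₁ X → Reachable E₁ S₁ Y →
                   (∀ p → p ≢ t₁ → X p ≡ Y p) → X t₁ ≡ Y t₁)
  {S : Assignment (V₁ × V₂)}
  (S-axis₁ : ∀ p → p ≢ t₁ → S (p , t₂) ≡ S₁ p)
  (S-axis₂ : ∀ v → S (t₁ , v) ≡ S₂ v)
  (S-off-axes : ∀ p v → p ≢ t₁ → v ≢ t₂ → S (p , v) ≤ 1)
  where

  private
    module F₁ = Realisation φ
    module F₂ = Realisation ψ
    A : V₁ → Assignment V₁
    A = F₁.assignment
    B : V₂ → Assignment V₂
    B = F₂.assignment

  _≟ₓ_ : DecidableEquality (V₁ × V₂)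
  _≟ₓ_ = ≡-dec _≟₁_ _≟₂_

  -- The shared sink also collects X t₁ ∸ S₁ t₁, the pebbles sent to t₁ inside the first factor.
  glue : Assignment V₁ → Assignment V₂ → Assignment (V₁ × V₂)
  glue X Y (p , v) with p ≟₁ t₁ | v ≟₂ t₂
  ... | yes _ | yes _ = Y t₂ + (X t₁ ∸ S₁ t₁)
  ... | yes _ | no _  = Y v
  ... | no _  | yes _ = X p
  ... | no _  | no _  = S (p , v)

  glue-sink : ∀ X Y → glue X Y (t₁ , t₂) ≡ Y t₂ + (X t₁ ∸ S₁ t₁)
  glue-sink X Y with t₁ ≟₁ t₁ | t₂ ≟₂ t₂
  ... | yes _    | yes _    = refl
  ... | yes _    | no t₂≢t₂ = ⊥-elim (t₂≢t₂ refl)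
  ... | no t₁≢t₁ | _        = ⊥-elim (t₁≢t₁ refl)

  glue-axis₂ : ∀ {X Y v} → v ≢ t₂ → glue X Y (t₁ , v) ≡ Y v
  glue-axis₂ {v = v} v≢t₂ with t₁ ≟₁ t₁ | v ≟₂ t₂
  ... | yes _    | yes v≡t₂ = ⊥-elim (v≢t₂ v≡t₂)
  ... | yes _    | no _     = refl
  ... | no t₁≢t₁ | _        = ⊥-elim (t₁≢t₁ refl)

  glue-axis₁ : ∀ {X Y p} → p ≢ t₁ → glue X Y (p , t₂) ≡ X p
  glue-axis₁ {p = p} p≢t₁ with p ≟₁ t₁ | t₂ ≟₂ t₂
  ... | yes p≡t₁ | _        = ⊥-elim (p≢t₁ p≡t₁)
  ... | no _     | yes _    = refl
  ... | no _     | no t₂≢t₂ = ⊥-elim (t₂≢t₂ refl)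

  glue-off : ∀ {X Y p v} → p ≢ t₁ → v ≢ t₂ → glue X Y (p , v) ≡ S (p , v)
  glue-off {p = p} {v} p≢t₁ v≢t₂ with p ≟₁ t₁ | v ≟₂ t₂
  ... | yes p≡t₁ | _        = ⊥-elim (p≢t₁ p≡t₁)
  ... | no _     | yes v≡t₂ = ⊥-elim (v≢t₂ v≡t₂)
  ... | no _     | no _     = refl

  data Position : V₁ × V₂ → Set where
    sink  : Position (t₁ , t₂)
    axis₂ : ∀ {v} → v ≢ t₂ → Position (t₁ , v)
    axis₁ : ∀ {p} → p ≢ t₁ → Position (p , t₂)
    off   : ∀ {p v} → p ≢ t₁ → v ≢ t₂ → Position (p , v)

  position : ∀ x → Position x
  position (p , v) with p ≟₁ t₁ | v ≟₂ t₂
  ... | yes refl | yes refl = sink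
  ... | yes refl | no v≢t₂  = axis₂ v≢t₂
  ... | no p≢t₁  | yes refl = axis₁ p≢t₁
  ... | no p≢t₁  | no v≢t₂  = off p≢t₁ v≢t₂

  glue-cong-at : ∀ {X X′ Y Y′} x → (∀ {p} → x ≡ (p , t₂) → X p ≡ X′ p) →
                 (∀ {v} → x ≡ (t₁ , v) → Y v ≡ Y′ v) → glue X Y x ≡ glue X′ Y′ x
  glue-cong-at {X} {X′} {Y} {Y′} x rows cols with position x
  ... | sink = begin
    glue X Y (t₁ , t₂)       ≡⟨ glue-sink X Y ⟩
    Y t₂ + (X t₁ ∸ S₁ t₁)     ≡⟨ cong₂ (λ a b → a + (b ∸ S₁ t₁)) (cols refl) (rows refl) ⟩
    Y′ t₂ + (X′ t₁ ∸ S₁ t₁)   ≡⟨ glue-sink X′ Y′ ⟨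
    glue X′ Y′ (t₁ , t₂)     ∎
    where open ≡-Reasoning
  ... | axis₂ v≢t₂    = trans (glue-axis₂ v≢t₂) (trans (cols refl) (sym (glue-axis₂ v≢t₂)))
  ... | axis₁ p≢t₁    = trans (glue-axis₁ p≢t₁) (trans (rows refl) (sym (glue-axis₁ p≢t₁)))
  ... | off p≢t₁ v≢t₂ = trans (glue-off p≢t₁ v≢t₂) (sym (glue-off p≢t₁ v≢t₂))

  glue-resp-≗ : ∀ {X X′ Y Y′} → X ≗ X′ → Y ≗ Y′ → glue X Y ≗ glue X′ Y′
  glue-resp-≗ X≗X′ Y≗Y′ x = glue-cong-at x (λ _ → X≗X′ _) (λ _ → Y≗Y′ _)

  S≗glue-S₁-S₂ : S ≗ glue S₁ S₂
  S≗glue-S₁-S₂ x with position x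
  ... | sink = begin
    S (t₁ , t₂)                ≡⟨ S-axis₂ t₂ ⟩
    S₂ t₂                      ≡⟨ +-identityʳ (S₂ t₂) ⟨
    S₂ t₂ + 0                  ≡⟨ cong (S₂ t₂ +_) (n∸n≡0 (S₁ t₁)) ⟨
    S₂ t₂ + (S₁ t₁ ∸ S₁ t₁)    ≡⟨ glue-sink S₁ S₂ ⟨
    glue S₁ S₂ (t₁ , t₂)       ∎
    where open ≡-Reasoning
  ... | axis₂ v≢t₂    = trans (S-axis₂ _) (sym (glue-axis₂ v≢t₂))
  ... | axis₁ p≢t₁    = trans (S-axis₁ _ p≢t₁) (sym (glue-axis₁ p≢t₁))
  ... | off p≢t₁ v≢t₂ = sym (glue-off p≢t₁ v≢t₂)

  off-axes-stuck : ∀ {X Y p v} → p ≢ t₁ → v ≢ t₂ → ¬ 2 ≤ glue X Y (p , v)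
  off-axes-stuck p≢t₁ v≢t₂ 2≤ =
    <-irrefl refl (≤-trans 2≤ (subst (_≤ 1) (sym (glue-off p≢t₁ v≢t₂)) (S-off-axes _ _ p≢t₁ v≢t₂)))

  glue-moveAlong₁ : ∀ {u w X X′ Y} → S₁ t₁ ≤ X t₁ → MoveAlong E₁ u w X X′ →
          MoveAlong (E₁ □ E₂) (u , t₂) (w , t₂) (glue X Y) (glue X′ Y)
  glue-moveAlong₁ {u} {w} {X} {X′} {Y} S₁≤X (e , 2≤Xu , Xu≡2+X′u , X′w≡1+Xw , frame) =
    inj₁ (e , refl) ,
    subst (2 ≤_) (sym (glue-axis₁ u≢t₁)) 2≤Xu ,
    trans (glue-axis₁ u≢t₁) (trans Xu≡2+X′u (cong (2 +_) (sym (glue-axis₁ u≢t₁)))) ,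
    at-target (w ≟₁ t₁) ,
    λ x x≢u x≢w → glue-cong-at x
      (λ { refl → frame _ (x≢u ∘ cong (_, t₂)) (x≢w ∘ cong (_, t₂)) }) (λ _ → refl)
    where
    open ≡-Reasoning
    u≢t₁ : u ≢ t₁
    u≢t₁ refl = t₁-sink w e
    at-target : Dec (w ≡ t₁) → glue X′ Y (w , t₂) ≡ 1 + glue X Y (w , t₂)
    at-target (yes refl) = begin
      glue X′ Y (t₁ , t₂)            ≡⟨ glue-sink X′ Y ⟩
      Y t₂ + (X′ t₁ ∸ S₁ t₁)         ≡⟨ cong (λ a → Y t₂ + (a ∸ S₁ t₁)) X′w≡1+Xw ⟩
      Y t₂ + (1 + X t₁ ∸ S₁ t₁)      ≡⟨ cong (Y t₂ +_) (+-∸-assoc 1 S₁≤X) ⟩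
      Y t₂ + (1 + (X t₁ ∸ S₁ t₁))    ≡⟨ +-suc (Y t₂) _ ⟩
      1 + (Y t₂ + (X t₁ ∸ S₁ t₁))    ≡⟨ cong suc (glue-sink X Y) ⟨
      1 + glue X Y (t₁ , t₂)         ∎
    at-target (no w≢t₁) = trans (glue-axis₁ w≢t₁) (trans X′w≡1+Xw (cong suc (sym (glue-axis₁ w≢t₁))))

  glue-moveAlong₂ : ∀ {u w X Y Y′} → MoveAlong E₂ u w Y Y′ →
          MoveAlong (E₁ □ E₂) (t₁ , u) (t₁ , w) (glue X Y) (glue X Y′)
  glue-moveAlong₂ {u} {w} {X} {Y} {Y′} (e , 2≤Yu , Yu≡2+Y′u , Y′w≡1+Yw , frame) =
    inj₂ (refl , e) ,
    subst (2 ≤_) (sym (glue-axis₂ u≢t₂)) 2≤Yu ,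
    trans (glue-axis₂ u≢t₂) (trans Yu≡2+Y′u (cong (2 +_) (sym (glue-axis₂ u≢t₂)))) ,
    at-target (w ≟₂ t₂) ,
    λ x x≢u x≢w → glue-cong-at x
      (λ _ → refl) (λ { refl → frame _ (x≢u ∘ cong (t₁ ,_)) (x≢w ∘ cong (t₁ ,_)) })
    where
    u≢t₂ : u ≢ t₂
    u≢t₂ refl = t₂-sink w e
    at-target : Dec (w ≡ t₂) → glue X Y′ (t₁ , w) ≡ 1 + glue X Y (t₁ , w)
    at-target (yes refl) = trans (glue-sink X Y′)
          (trans (cong (_+ (X t₁ ∸ S₁ t₁)) Y′w≡1+Yw) (cong suc (sym (glue-sink X Y))))
    at-target (no w≢t₂)  = trans (glue-axis₂ w≢t₂) (trans Y′w≡1+Yw (cong suc (sym (glue-axis₂ w≢t₂))))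

  glue-reachable₁ : ∀ {X X′ Y} → S₁ t₁ ≤ X t₁ → Reachable E₁ X X′ →
           Reachable (E₁ □ E₂) (glue X Y) (glue X′ Y)
  glue-reachable₁ S₁≤X ε                   = ε
  glue-reachable₁ S₁≤X ((_ , _ , mv) ◅ mvs) =
    (_ , _ , glue-moveAlong₁ S₁≤X mv) ◅
    glue-reachable₁ (≤-trans S₁≤X (moveAlong-sink-≤ _≟₁_ t₁-sink mv)) mvs

  glue-reachable₂ : ∀ {X Y Y′} → Reachable E₂ Y Y′ → Reachable (E₁ □ E₂) (glue X Y) (glue X Y′)
  glue-reachable₂ ε                   = ε
  glue-reachable₂ ((_ , _ , mv) ◅ mvs) = (_ , _ , glue-moveAlong₂ mv) ◅ glue-reachable₂ mvs

  glue-move⁻ : ∀ {X Y Z} → S₁ t₁ ≤ X t₁ → Move (E₁ □ E₂) (glue X Y) Z →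
               Σ (Assignment V₁) (λ X′ → Move E₁ X X′ × Z ≗ glue X′ Y) ⊎
               Σ (Assignment V₂) (λ Y′ → Move E₂ Y Y′ × Z ≗ glue X Y′)
  glue-move⁻ {X} S₁≤X ((p , v) , (q , _) , mv@(inj₁ (e , refl) , 2≤ , _)) = case v ≟₂ t₂ of λ
    { (no v≢t₂) → ⊥-elim (off-axes-stuck p≢t₁ v≢t₂ 2≤)
    ; (yes refl) → let mvX = fire₁ (subst (2 ≤_) (glue-axis₁ p≢t₁) 2≤) in
        inj₁ (_ , (p , q , mvX) ,
              moveAlong-functional {E = E₁ □ E₂} _≟ₓ_ (λ _ → refl) mv (glue-moveAlong₁ S₁≤X mvX))
    }
    where
    p≢t₁ : p ≢ t₁
    p≢t₁ refl = t₁-sink q e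
    fire₁ : 2 ≤ X p → MoveAlong E₁ p q X (fire _≟₁_ X p q)
    fire₁ 2≤Xp =
      moveAlong-fire {E = E₁} _≟₁_ e 2≤Xp (moveAlong-source≢target {E = E₁ □ E₂} mv ∘ cong (_, v))
  glue-move⁻ {Y = Y} _ ((p , v) , (_ , w) , mv@(inj₂ (refl , e) , 2≤ , _)) = case p ≟₁ t₁ of λ
    { (no p≢t₁) → ⊥-elim (off-axes-stuck p≢t₁ v≢t₂ 2≤)
    ; (yes refl) → let mvY = fire₂ (subst (2 ≤_) (glue-axis₂ v≢t₂) 2≤) in
        inj₂ (_ , (v , w , mvY) ,
              moveAlong-functional {E = E₁ □ E₂} _≟ₓ_ (λ _ → refl) mv (glue-moveAlong₂ mvY))
    }
    where
    v≢t₂ : v ≢ t₂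
    v≢t₂ refl = t₂-sink w e
    fire₂ : 2 ≤ Y v → MoveAlong E₂ v w Y (fire _≟₂_ Y v w)
    fire₂ 2≤Yv =
      moveAlong-fire {E = E₂} _≟₂_ e 2≤Yv (moveAlong-source≢target {E = E₁ □ E₂} mv ∘ cong (p ,_))

  glued : V₁ × V₂ → Assignment (V₁ × V₂)
  glued (p , v) = glue (A p) (B v)

  S₁≤A : ∀ p → S₁ t₁ ≤ A p t₁
  S₁≤A p = reachable-sink-≤ _≟₁_ t₁-sink (F₁.assignment-reachable p)

  glued-reachable : ∀ x → Σ (Assignment (V₁ × V₂)) λ Z → Reachable (E₁ □ E₂) S Z × Z ≗ glued x
  glued-reachable (p , v) = reachable-resp-≗ˡ S≗glue-S₁-S₂
    (glue-reachable₁ ≤-refl (F₁.assignment-reachable p) ◅◅ glue-reachable₂ (F₂.assignment-reachable v))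

  glued-edge : ∀ {x y} → (E₁ □ E₂) x y → Move (E₁ □ E₂) (glued x) (glued y)
  glued-edge {p , _} (inj₁ (e , refl)) =
    let u , w , mv = F₁.assignment-edge e in (u , _) , (w , _) , glue-moveAlong₁ (S₁≤A p) mv
  glued-edge (inj₂ (refl , e)) =
    let u , w , mv = F₂.assignment-edge e in (_ , u) , (_ , w) , glue-moveAlong₂ mv

  glued-move : ∀ {x Z} → Move (E₁ □ E₂) (glued x) Z → Σ (V₁ × V₂) λ y → (E₁ □ E₂) x y × Z ≗ glued y
  glued-move {p , v} mv with glue-move⁻ (S₁≤A p) mv
  ... | inj₁ (_ , mvX , Z≗glue) =
    let q , e , Aq≗X′ = F₁.assignment-move mvX
    in (q , v) , inj₁ (e , refl) , λ x → trans (Z≗glue x) (glue-resp-≗ (sym ∘ Aq≗X′) (λ _ → refl) x)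
  ... | inj₂ (_ , mvY , Z≗glue) =
    let w , e , Bw≗Y′ = F₂.assignment-move mvY
    in (p , w) , inj₂ (refl , e) , λ x → trans (Z≗glue x) (glue-resp-≗ (λ _ → refl) (sym ∘ Bw≗Y′) x)

  glued-injective : ∀ {x y} → glued x ≗ glued y → x ≡ y
  glued-injective {p , v} {q , w} eq =
    cong₂ _,_ (F₁.assignment-injective Ap≗Aq) (F₂.assignment-injective Bv≗Bw)
    where
    open ≡-Reasoning
    agree-off-t₁ : ∀ r → r ≢ t₁ → A p r ≡ A q r
    agree-off-t₁ r r≢t₁ = trans (sym (glue-axis₁ r≢t₁)) (trans (eq (r , t₂)) (glue-axis₁ r≢t₁))
    Ap≗Aq : A p ≗ A q
    Ap≗Aq r with r ≟₁ t₁
    ... | yes refl = t₁-determined (F₁.assignment-reachable p) (F₁.assignment-reachable q) agree-off-t₁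
    ... | no r≢t₁  = agree-off-t₁ r r≢t₁
    Bv≗Bw : B v ≗ B w
    Bv≗Bw u with u ≟₂ t₂
    ... | yes refl = +-cancelʳ-≡ (A p t₁ ∸ S₁ t₁) _ _ (begin
      B v t₂ + (A p t₁ ∸ S₁ t₁)   ≡⟨ glue-sink (A p) (B v) ⟨
      glued (p , v) (t₁ , t₂)     ≡⟨ eq (t₁ , t₂) ⟩
      glued (q , w) (t₁ , t₂)     ≡⟨ glue-sink (A q) (B w) ⟩
      B w t₂ + (A q t₁ ∸ S₁ t₁)   ≡⟨ cong (λ a → B w t₂ + (a ∸ S₁ t₁)) (Ap≗Aq t₁) ⟨
      B w t₂ + (A p t₁ ∸ S₁ t₁)   ∎)
    ... | no u≢t₂  = trans (sym (glue-axis₂ u≢t₂)) (trans (eq (t₁ , u)) (glue-axis₂ u≢t₂))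

  reachable-glued : ∀ {Y Z} x → Y ≗ glued x → Reachable (E₁ □ E₂) Y Z →
                    Σ (V₁ × V₂) λ y → Z ≗ glued y
  reachable-glued x Y≗glued ε          = x , Y≗glued
  reachable-glued x Y≗glued (mv ◅ mvs) =
    let y , _ , Z≗glued = glued-move (move-resp-≗ Y≗glued (λ _ → refl) mv)
    in reachable-glued y Z≗glued mvs

  realises : Realises (E₁ □ E₂) S
  realises = record
    { f       = vertex
    ; f-cong  = λ { refl _ → refl }
    ; f-inj   = λ {x} {y} fx≈fy → glued-injective λ z →
                  trans (sym (vertex≗glued x z)) (trans (fx≈fy z) (vertex≗glued y z))
    ; f-surj  = surjective
    ; f-edge  = λ {x} {y} e → move-resp-≗ (sym ∘ vertex≗glued x) (sym ∘ vertex≗glued y) (glued-edge e)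
    ; f-edge⁻ = edge⁻
    }
    where
    vertex : V₁ × V₂ → Σ (Assignment (V₁ × V₂)) (Reachable (E₁ □ E₂) S)
    vertex x = let Z , S↝Z , _ = glued-reachable x in Z , S↝Z
    vertex≗glued : ∀ x → proj₁ (vertex x) ≗ glued x
    vertex≗glued x = proj₂ (proj₂ (glued-reachable x))
    surjective : ∀ Z → Σ (V₁ × V₂) λ x → proj₁ (vertex x) ≗ proj₁ Z
    surjective (Z , S↝Z) =
      let A₀ = F₁.assignment-surjective ε
          B₀ = F₂.assignment-surjective ε
          y , Z≗glued = reachable-glued (proj₁ A₀ , proj₁ B₀)
            (λ x → trans (S≗glue-S₁-S₂ x) (glue-resp-≗ (sym ∘ proj₂ A₀) (sym ∘ proj₂ B₀) x)) S↝Z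
      in y , λ x → trans (vertex≗glued y x) (sym (Z≗glued x))
    edge⁻ : ∀ {x y} → Move (E₁ □ E₂) (proj₁ (vertex x)) (proj₁ (vertex y)) → (E₁ □ E₂) x y
    edge⁻ {x} {y} mv =
      let y′ , e , Zy≗glued = glued-move (move-resp-≗ (vertex≗glued x) (λ _ → refl) mv)
      in subst ((E₁ □ E₂) x) (glued-injective λ z → trans (sym (Zy≗glued z)) (vertex≗glued y z)) e

vertex-≟ : ∀ {r} (ns : Vec ℕ r) → DecidableEquality (Vertex ns)
vertex-≟ []       tt tt = yes refl
vertex-≟ (n ∷ ns) = ≡-dec Fin._≟_ (vertex-≟ ns)

AllSink : ∀ {r} (ns : Vec ℕ r) → Vertex ns → Set
AllSink ns v = ∀ i → IsSink (coord ns v i)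

allSink-noOutEdges : ∀ {r} (ns : Vec ℕ r) {v} → AllSink ns v → NoOutEdges (ProdEdge ns) v
allSink-noOutEdges (n ∷ ns) v-sink _ (inj₁ (e , _)) = isSink⇒noOutEdges (v-sink Fin.zero) _ e
allSink-noOutEdges (n ∷ ns) v-sink _ (inj₂ (_ , e)) = allSink-noOutEdges ns (v-sink ∘ Fin.suc) _ e

allSink-unique : ∀ {r} (ns : Vec ℕ r) {v w} → AllSink ns v → AllSink ns w → v ≡ w
allSink-unique []       _      _      = refl
allSink-unique (n ∷ ns) v-sink w-sink =
  cong₂ _,_ (toℕ-injective (suc-injective (trans (v-sink Fin.zero) (sym (w-sink Fin.zero)))))
            (allSink-unique ns (v-sink ∘ Fin.suc) (w-sink ∘ Fin.suc))

allSink-exists : ∀ {r} (ns : Vec ℕ r) → (∀ i → 0 < lookup ns i) → Σ (Vertex ns) (AllSink ns)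
allSink-exists []           _   = tt , λ ()
allSink-exists (zero ∷ ns)  pos = ⊥-elim (<-irrefl refl (pos Fin.zero))
allSink-exists (suc m ∷ ns) pos =
  let v , v-sink = allSink-exists ns (pos ∘ Fin.suc)
  in (fromℕ m , v) , λ { Fin.zero → isSink-fromℕ m ; (Fin.suc i) → v-sink i }

-- Unlike Corresponding, this leaves the global sink free also when r = 0; it is inherited by slices.
CorrespondingOffSink : ∀ {r} (ns : Vec ℕ r) → ((i : Fin r) → Assignment (Fin (lookup ns i))) →
                       Assignment (Vertex ns) → Set
CorrespondingOffSink {r} ns S SG =
  (∀ (i : Fin r) v → OnAxis ns i v → ¬ IsSink (coord ns v i) → SG v ≡ S i (coord ns v i)) ×
  (∀ v → (∀ i → ¬ OnAxis ns i v) → ¬ AllSink ns v → SG v ≤ 1)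

product-realises : ∀ {r} (ns : Vec ℕ r) → (∀ i → 0 < lookup ns i) →
                   (S : (i : Fin r) → Assignment (Fin (lookup ns i))) →
                   (∀ i → Realises PathEdge (S i)) →
                   (SG : Assignment (Vertex ns)) → CorrespondingOffSink ns S SG →
                   Realises (ProdEdge ns) SG
product-realises [] _ _ _ SG _ = record
  { f       = λ _ → SG , ε
  ; f-cong  = λ _ _ → refl
  ; f-inj   = λ _ → refl
  ; f-surj  = λ { (_ , ε) → tt , λ _ → refl ; (_ , (_ , _ , () , _) ◅ _) }
  ; f-edge  = λ ()
  ; f-edge⁻ = λ { (_ , _ , () , _) }
  }
product-realises (zero ∷ ns) pos _ _ _ _ = ⊥-elim (<-irrefl refl (pos Fin.zero))
product-realises (suc m ∷ ns) pos S φ SG (on-axis , off-axes) =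
  Product.realises Fin._≟_ (vertex-≟ ns)
    (isSink⇒noOutEdges (isSink-fromℕ m)) (allSink-noOutEdges ns s-sink)
    (φ Fin.zero) ψ path-sink-determined S-axis₁ (λ _ → refl) S-off-axes
  where
  last : Fin (suc m)
  last = fromℕ m
  s : Vertex ns
  s = proj₁ (allSink-exists ns (pos ∘ Fin.suc))
  s-sink : AllSink ns s
  s-sink = proj₂ (allSink-exists ns (pos ∘ Fin.suc))
  slice-corresponds : CorrespondingOffSink ns (λ i → S (Fin.suc i)) (λ v → SG (last , v))
  slice-corresponds =
    (λ i v v-on-i → on-axis (Fin.suc i) (last , v)
       λ { Fin.zero _ → isSink-fromℕ m ; (Fin.suc l) l≢i → v-on-i l (l≢i ∘ cong Fin.suc) }) ,
    (λ v v-off v-not-sink → off-axes (last , v)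
       (λ { Fin.zero on-0 → v-not-sink λ j → on-0 (Fin.suc j) λ ()
          ; (Fin.suc i) on-i → v-off i λ l l≢i → on-i (Fin.suc l) (l≢i ∘ Finₚ.suc-injective) })
       λ all-sink → v-not-sink (all-sink ∘ Fin.suc))
  ψ : Realises (ProdEdge ns) (λ v → SG (last , v))
  ψ = product-realises ns (pos ∘ Fin.suc) (λ i → S (Fin.suc i)) (φ ∘ Fin.suc) _ slice-corresponds
  S-axis₁ : ∀ p → p ≢ last → SG (p , s) ≡ S Fin.zero p
  S-axis₁ p p≢last = on-axis Fin.zero (p , s)
    (λ { Fin.zero 0≢0 → ⊥-elim (0≢0 refl) ; (Fin.suc l) _ → s-sink l }) (p≢last ∘ isSink⇒≡fromℕ)
  S-off-axes : ∀ p v → p ≢ last → v ≢ s → SG (p , v) ≤ 1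
  S-off-axes p v p≢last v≢s = off-axes (p , v)
    (λ { Fin.zero on-0 → v≢s (allSink-unique ns (λ j → on-0 (Fin.suc j) λ ()) s-sink)
       ; (Fin.suc i) on-i → p≢last (isSink⇒≡fromℕ (on-i Fin.zero λ ())) })
    λ all-sink → p≢last (isSink⇒≡fromℕ (all-sink Fin.zero))

corollary7p1 : {r : ℕ} (ns : Vec ℕ r) →
    (∀ i → 2 ≤ lookup ns i) →
    (S : (i : Fin r) → Assignment (Fin (lookup ns i))) →
    (∀ i → AlmostSimple (lookup ns i) (S i)) →
    (∀ i → Iso (PathGraph (lookup ns i))
               (AssignmentGraph (Fin (lookup ns i)) PathEdge (S i))) →
    (SG : Assignment (Vertex ns)) →
    Corresponding ns S SG →
    Iso (ProdGraph ns) (AssignmentGraph (Vertex ns) (ProdEdge ns) SG)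
corollary7p1 ns 2≤n S _ φ SG (on-axis , off-axes) =
  product-realises ns (λ i → ≤-trans (s≤s z≤n) (2≤n i)) S φ SG
    (on-axis , λ v v-off _ → off-axes v v-off)
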